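{- There exist constants $c>0$ and $n_0$ such that for every $n\ge n_0$, every sub-matrix of $C_n$ of size $\sigma(n) \times \sigma(n)$ has Boolean rank at most $c\log\log n$.
   Context: $C_n$ is the $n\times n$ $0,1$ matrix with zeros on the main diagonal and ones elsewhere. $\sigma(n) = \min\{d : n \leq \binom{d}{\lfloor d/2\rfloor}\}$. A sub-matrix is obtained by selecting a subset of rows and a subset of columns. The Boolean rank of a $0,1$ matrix $M$ is the minimal $r$ with $M=A\cdot B$ for $0,1$ matrices $A,B$ of inner dimension $r$ under Boolean arithmetic ($1+1=1$); equivalently the minimum number of all-ones submatrices covering the $1$-entries of $M$. -}

module Defs where

open import Data.Nat using (ℕ; zero; suc; _≤_; _<_; _/_)
open import Data.Nat.Combinatorics using (_C_)
open import Data.Fin using (Fin) renaming (zero to fzero; suc to fsuc; _<_ to _<ᶠ_)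
import Data.Fin as F
open import Data.Bool using (Bool; true; false; _∨_; _∧_; not)
open import Data.Product using (Σ; _×_; ∃)
open import Relation.Nullary using (does)
open import Relation.Binary.PropositionalEquality using (_≡_)

BoolMatrix : ℕ → ℕ → Set
BoolMatrix m k = Fin m → Fin k → Bool

C-mat : (n : ℕ) → BoolMatrix n n
C-mat n i j = not (does (i F.≟ j))

⋁ : {r : ℕ} → (Fin r → Bool) → Bool
⋁ {zero}  f = false
⋁ {suc r} f = f fzero ∨ ⋁ (λ t → f (fsuc t))

_⊙_ : {m r k : ℕ} → BoolMatrix m r → BoolMatrix r k → BoolMatrix m k
(A ⊙ B) i j = ⋁ (λ t → A i t ∧ B t j)

BoolFactorization : {m k : ℕ} → BoolMatrix m k → ℕ → Set
BoolFactorization {m} {k} M r =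
  Σ (BoolMatrix m r) λ A → Σ (BoolMatrix r k) λ B → ∀ i j → M i j ≡ (A ⊙ B) i j

BoolRank≤ : {m k : ℕ} → BoolMatrix m k → ℕ → Set
BoolRank≤ M b = ∃ λ r → r ≤ b × BoolFactorization M r

StrictlyIncreasing : {s n : ℕ} → (Fin s → Fin n) → Set
StrictlyIncreasing f = ∀ i j → i <ᶠ j → f i <ᶠ f j

subMatrix : {m k s t : ℕ} → BoolMatrix m k → (Fin s → Fin m) → (Fin t → Fin k) → BoolMatrix s t
subMatrix M f g i j = M (f i) (g j)

-- s = σ(n) = min { d : n ≤ binom(d, ⌊d/2⌋) }.
IsSigma : ℕ → ℕ → Set
IsSigma n s = (n ≤ s C (s / 2)) × (∀ d → d < s → ¬≤ d)
  where
  ¬≤ : ℕ → Set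
  ¬≤ d = d C (d / 2) < n

{-# OPTIONS --safe #-}
-- Because the row selection f is injective, every column of the sub-matrix
-- contains at most one zero, so labelling column j by the row of its zero
-- (or by a fresh label) turns the sub-matrix into a sub-matrix of C_{s+1}.
-- For N ≤ b^k, C_N is covered by the k·b all-ones rectangles "digit p of the
-- row label is d, digit p of the column label is not d".  Minimality of
-- σ(n) gives 2^⌊(s-1)/2⌋ ≤ binom(s-1, ⌊(s-1)/2⌋) < n, so s ≤ 2 log₂ n + 2, and
-- binary labels of length log₂ log₂ n + 3 suffice.
module Submission where

open import Defs
open import Data.Nat using (ℕ; _≤_; _<_; _*_)
open import Data.Nat.Logarithm using (⌊log₂_⌋)
open import Data.Fin using (Fin)
open import Data.Product using (Σ; _×_)

open import Data.Bool using (Bool; true; false; not; _∧_)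
open import Data.Bool.Properties using (∧-inverseʳ)
open import Data.Empty using (⊥-elim)
open import Data.Fin using (zero; suc; combine; remQuot; finToFun; funToFin; inject≤; _≟_)
open import Data.Fin.Properties
  using (any?; ¬∀⟶∃¬; remQuot-combine; funToFin-finToFin; inject≤-injective; suc-injective; <-cmp; <-irrefl)
open import Data.Nat as ℕ using (zero; suc; _+_; _^_; _/_; _%_; z≤n; s≤s; _≤′_; ≤′-refl; ≤′-step)
open import Data.Nat.Combinatorics using (_C_; nCk+nC[k+1]≡[n+1]C[k+1])
open import Data.Nat.DivMod using (m≡m%n+[m/n]*n; m%n<n; m/n*n≤m)
open import Data.Nat.Logarithm using (⌊log₂⌋-mono-≤; ⌊log₂[2^n]⌋≡n)
open import Data.Nat.Properties hiding (_≟_; suc-injective; <-cmp; <-irrefl)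
open import Data.Product using (∃; _,_)
open import Function using (_∘_; _⇔_; mk⇔)
open import Function.Definitions using (Injective)
open import Relation.Binary using (tri<; tri≈; tri>)
open import Relation.Binary.PropositionalEquality
open import Relation.Nullary using (Dec; yes; no; does)
open import Relation.Nullary.Decidable using (does-⇔; dec-true; dec-false)

nCk≤[1+n]Ck : ∀ n k → n C k ≤ suc n C k
nCk≤[1+n]Ck n zero    = ≤-refl
nCk≤[1+n]Ck n (suc k) = begin
  n C suc k              ≤⟨ m≤n+m _ _ ⟩
  n C k + n C suc k      ≡⟨ nCk+nC[k+1]≡[n+1]C[k+1] n k ⟩
  suc n C suc k          ∎
  where open ≤-Reasoning

C-monoˡ-≤ : ∀ {m n} k → m ≤ n → m C k ≤ n C k
C-monoˡ-≤ {m} k m≤n = go (≤⇒≤′ m≤n)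
  where
  go : ∀ {n} → m ≤′ n → m C k ≤ n C k
  go ≤′-refl       = ≤-refl
  go (≤′-step m≤n) = ≤-trans (go m≤n) (nCk≤[1+n]Ck _ k)

2^n≤[n*2]Cn : ∀ n → 2 ^ n ≤ (n * 2) C n
2^n≤[n*2]Cn zero    = ≤-refl
2^n≤[n*2]Cn (suc n) = begin
  2 ^ suc n                                    ≡⟨ cong (2 ^ n +_) (+-identityʳ (2 ^ n)) ⟩
  2 ^ n + 2 ^ n                                ≤⟨ +-mono-≤ (2^n≤[n*2]Cn n) (2^n≤[n*2]Cn n) ⟩
  (n * 2) C n + (n * 2) C n                    ≤⟨ +-mono-≤ (nCk≤[1+n]Ck (n * 2) n) (m≤m+n _ _) ⟩
  suc (n * 2) C n + ((n * 2) C n + (n * 2) C suc n)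
    ≡⟨ cong (suc (n * 2) C n +_) (nCk+nC[k+1]≡[n+1]C[k+1] (n * 2) n) ⟩
  suc (n * 2) C n + suc (n * 2) C suc n        ≡⟨ nCk+nC[k+1]≡[n+1]C[k+1] (suc (n * 2)) n ⟩
  (suc n * 2) C suc n                          ∎
  where open ≤-Reasoning

2^[n/2]≤nC[n/2] : ∀ n → 2 ^ (n / 2) ≤ n C (n / 2)
2^[n/2]≤nC[n/2] n = ≤-trans (2^n≤[n*2]Cn (n / 2)) (C-monoˡ-≤ (n / 2) (m/n*n≤m n 2))

n≤1+[n/2]*2 : ∀ n → n ≤ suc (n / 2 * 2)
n≤1+[n/2]*2 n = begin
  n                  ≡⟨ m≡m%n+[m/n]*n n 2 ⟩
  n % 2 + n / 2 * 2  ≤⟨ +-monoˡ-≤ (n / 2 * 2) (≤-pred (m%n<n n 2)) ⟩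
  suc (n / 2 * 2)    ∎
  where open ≤-Reasoning

2^m≤n⇒m≤⌊log₂n⌋ : ∀ {m n} → 2 ^ m ≤ n → m ≤ ⌊log₂ n ⌋
2^m≤n⇒m≤⌊log₂n⌋ {m} 2^m≤n = subst (_≤ _) (⌊log₂[2^n]⌋≡n m) (⌊log₂⌋-mono-≤ 2^m≤n)

n<2^[1+⌊log₂n⌋] : ∀ n → n < 2 ^ suc ⌊log₂ n ⌋
n<2^[1+⌊log₂n⌋] n with suc n ℕ.≤? 2 ^ suc ⌊log₂ n ⌋
... | yes n<2^[1+L] = n<2^[1+L]
... | no  n≮2^[1+L] = ⊥-elim (n≮n _ (2^m≤n⇒m≤⌊log₂n⌋ (≤-pred (≰⇒> n≮2^[1+L]))))

σ≤[1+⌊log₂n⌋]*2 : ∀ {n s} → IsSigma n s → s ≤ suc ⌊log₂ n ⌋ * 2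
σ≤[1+⌊log₂n⌋]*2 {s = zero}  _                 = z≤n
σ≤[1+⌊log₂n⌋]*2 {n} {suc d} (_ , d-too-small) = s≤s (begin
  d                      ≤⟨ n≤1+[n/2]*2 d ⟩
  suc (d / 2 * 2)        ≤⟨ s≤s (*-monoˡ-≤ 2 d/2≤⌊log₂n⌋) ⟩
  suc (⌊log₂ n ⌋ * 2)    ∎)
  where
  open ≤-Reasoning
  d/2≤⌊log₂n⌋ : d / 2 ≤ ⌊log₂ n ⌋
  d/2≤⌊log₂n⌋ = 2^m≤n⇒m≤⌊log₂n⌋ (<⇒≤ (≤-<-trans (2^[n/2]≤nC[n/2] d) (d-too-small d ≤-refl)))

σ<2^[3+⌊log₂⌊log₂n⌋⌋] : ∀ {n s} → IsSigma n s → s < 2 ^ (3 + ⌊log₂ ⌊log₂ n ⌋ ⌋)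
σ<2^[3+⌊log₂⌊log₂n⌋⌋] {n} {s} σ = begin-strict
  s                  ≤⟨ σ≤[1+⌊log₂n⌋]*2 σ ⟩
  suc L * 2          ≤⟨ *-monoˡ-≤ 2 (n<2^[1+⌊log₂n⌋] L) ⟩
  2 ^ suc l * 2      ≡⟨ *-comm (2 ^ suc l) 2 ⟩
  2 ^ (2 + l)        <⟨ ^-monoʳ-< 2 (s≤s (s≤s z≤n)) (n<1+n (2 + l)) ⟩
  2 ^ (3 + l)        ∎
  where
  open ≤-Reasoning
  L l : ℕ
  L = ⌊log₂ n ⌋
  l = ⌊log₂ L ⌋

[3+n]*2≤8*n : ∀ {n} → 1 ≤ n → (3 + n) * 2 ≤ 8 * n
[3+n]*2≤8*n {suc n} _ = begin
  8 + n * 2    ≤⟨ +-monoʳ-≤ 8 (*-monoʳ-≤ n (s≤s (s≤s z≤n))) ⟩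
  8 + n * 8    ≡⟨ cong (8 +_) (*-comm n 8) ⟩
  8 + 8 * n    ≡⟨ *-suc 8 n ⟨
  8 * suc n    ∎
  where open ≤-Reasoning

⋁-false : ∀ {r} (h : Fin r → Bool) → (∀ t → h t ≡ false) → ⋁ h ≡ false
⋁-false {zero}  h h≡false = refl
⋁-false {suc r} h h≡false rewrite h≡false zero = ⋁-false (h ∘ suc) (h≡false ∘ suc)

⋁-true : ∀ {r} (h : Fin r → Bool) t → h t ≡ true → ⋁ h ≡ true
⋁-true h zero    ht≡true rewrite ht≡true = refl
⋁-true h (suc t) ht≡true with h zero
... | true  = refl
... | false = ⋁-true (h ∘ suc) t ht≡true

BoolFactorization-reindex : ∀ {m k m′ k′ r} {M : BoolMatrix m k} {N : BoolMatrix m′ k′}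
  (ρ : Fin m → Fin m′) (κ : Fin k → Fin k′) → (∀ i j → M i j ≡ N (ρ i) (κ j)) →
  BoolFactorization N r → BoolFactorization M r
BoolFactorization-reindex ρ κ M≡N (A , B , N≡A⊙B) =
  A ∘ ρ , (λ t → B t ∘ κ) , λ i j → trans (M≡N i j) (N≡A⊙B (ρ i) (κ j))

funToFin-cong : ∀ {m n} {u v : Fin m → Fin n} → u ≗ v → funToFin u ≡ funToFin v
funToFin-cong {zero}  u≗v = refl
funToFin-cong {suc m} u≗v = cong₂ combine (u≗v zero) (funToFin-cong (u≗v ∘ suc))

finToFun-injective : ∀ {m n} {x y : Fin (m ^ n)} → finToFun {m} {n} x ≗ finToFun y → x ≡ y
finToFun-injective {m} {n} {x} {y} x≗y = begin
  x                              ≡⟨ funToFin-finToFin {n} x ⟨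
  funToFin (finToFun {m} {n} x)  ≡⟨ funToFin-cong x≗y ⟩
  funToFin (finToFun {m} {n} y)  ≡⟨ funToFin-finToFin {n} y ⟩
  y                              ∎
  where open ≡-Reasoning

digitIs : ∀ {b k} → (Fin k → Fin b) → Fin (k * b) → Bool
digitIs {b} u t = let p , d = remQuot b t in does (u p ≟ d)

digitIs-combine : ∀ {b k} (u : Fin k → Fin b) p d → digitIs u (combine p d) ≡ does (u p ≟ d)
digitIs-combine {b} u p d = cong (λ (p , d) → does (u p ≟ d)) (remQuot-combine {k = b} p d)

digitIs-separates : ∀ {b k} (u v : Fin k → Fin b) p → u p ≢ v p →
  digitIs u (combine p (u p)) ∧ not (digitIs v (combine p (u p))) ≡ true
digitIs-separates u v p up≢vp = begin
  digitIs u (combine p (u p)) ∧ not (digitIs v (combine p (u p)))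
    ≡⟨ cong₂ (λ x y → x ∧ not y) (digitIs-combine u p (u p)) (digitIs-combine v p (u p)) ⟩
  does (u p ≟ u p) ∧ not (does (v p ≟ u p))
    ≡⟨ cong₂ (λ x y → x ∧ not y) (dec-true (u p ≟ u p) refl) (dec-false (v p ≟ u p) (up≢vp ∘ sym)) ⟩
  true
    ∎
  where open ≡-Reasoning

C-mat-factorization : ∀ b k → BoolFactorization (C-mat (b ^ k)) (k * b)
C-mat-factorization b k = (λ x → digitIs (digits x)) , (λ t y → not (digitIs (digits y) t)) , entry
  where
  digits : Fin (b ^ k) → Fin k → Fin b
  digits = finToFun

  entry : ∀ x y → C-mat (b ^ k) x y ≡ ⋁ (λ t → digitIs (digits x) t ∧ not (digitIs (digits y) t))
  entry x y with x ≟ y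
  ... | yes refl = sym (⋁-false _ (λ t → ∧-inverseʳ (digitIs (digits x) t)))
  ... | no  x≢y  =
    let p , xp≢yp = ¬∀⟶∃¬ k _ (λ p → digits x p ≟ digits y p) (x≢y ∘ finToFun-injective)
    in sym (⋁-true _ (combine p (digits x p)) (digitIs-separates (digits x) (digits y) p xp≢yp))

C-mat-injective : ∀ {m n} {h : Fin m → Fin n} → Injective _≡_ _≡_ h →
  ∀ x y → C-mat n (h x) (h y) ≡ C-mat m x y
C-mat-injective {h = h} h-injective x y =
  cong not (does-⇔ (mk⇔ h-injective (cong h)) (h x ≟ h y) (x ≟ y))

module _ {s n} {f : Fin s → Fin n} where

  preimageCode : ∀ {y} → Dec (∃ λ i → f i ≡ y) → Fin (suc s)
  preimageCode (yes (i , _)) = suc i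
  preimageCode (no _)        = zero

  ≡⇔suc≡preimageCode : Injective _≡_ _≡_ f → ∀ {i y} (i′? : Dec (∃ λ i′ → f i′ ≡ y)) →
    f i ≡ y ⇔ suc i ≡ preimageCode i′?
  ≡⇔suc≡preimageCode f-injective (yes (i′ , fi′≡y)) =
    mk⇔ (λ fi≡y → cong suc (f-injective (trans fi≡y (sym fi′≡y))))
        (λ i≡i′ → trans (cong f (suc-injective i≡i′)) fi′≡y)
  ≡⇔suc≡preimageCode _ {i} (no ∄i′) = mk⇔ (λ fi≡y → ⊥-elim (∄i′ (i , fi≡y))) λ ()

  C-mat-injectiveˡ : Injective _≡_ _≡_ f → ∀ {t} (g : Fin t → Fin n) →
    ∃ λ (κ : Fin t → Fin (suc s)) → ∀ i j → C-mat n (f i) (g j) ≡ C-mat (suc s) (suc i) (κ j)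
  C-mat-injectiveˡ f-injective {t} g = κ , λ i j →
    cong not (does-⇔ (≡⇔suc≡preimageCode f-injective (preimage j)) (f i ≟ g j) (suc i ≟ κ j))
    where
    preimage : ∀ j → Dec (∃ λ i → f i ≡ g j)
    preimage j = any? (λ i → f i ≟ g j)
    κ : Fin t → Fin (suc s)
    κ j = preimageCode (preimage j)

  subMatrix-C-mat-factorization : Injective _≡_ _≡_ f → ∀ {t} (g : Fin t → Fin n) b k → s < b ^ k →
    BoolFactorization (subMatrix (C-mat n) f g) (k * b)
  subMatrix-C-mat-factorization f-injective g b k s<b^k =
    let κ , fg≡κ = C-mat-injectiveˡ f-injective g in
    BoolFactorization-reindex (embed ∘ suc) (embed ∘ κ)
      (λ i j → trans (fg≡κ i j) (sym (C-mat-injective {h = embed} embed-injective (suc i) (κ j))))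
      (C-mat-factorization b k)
    where
    embed : Fin (suc s) → Fin (b ^ k)
    embed x = inject≤ x s<b^k
    embed-injective : Injective _≡_ _≡_ embed
    embed-injective = inject≤-injective _ _ _ _

strictlyIncreasing⇒injective : ∀ {s n} {f : Fin s → Fin n} → StrictlyIncreasing f →
  Injective _≡_ _≡_ f
strictlyIncreasing⇒injective {f = f} f↑ {i} {j} fi≡fj with <-cmp i j
... | tri< i<j _ _ = ⊥-elim (<-irrefl fi≡fj (f↑ i j i<j))
... | tri≈ _ i≡j _ = i≡j
... | tri> _ _ j<i = ⊥-elim (<-irrefl (sym fi≡fj) (f↑ j i j<i))

mainTheorem10 : Σ ℕ λ c → Σ ℕ λ n₀ → (0 < c) ×
    (∀ n → n₀ ≤ n → ∀ s → IsSigma n s →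
    (f g : Fin s → Fin n) → StrictlyIncreasing f → StrictlyIncreasing g →
    BoolRank≤ (subMatrix (C-mat n) f g) (c * ⌊log₂ ⌊log₂ n ⌋ ⌋))
mainTheorem10 = 8 , 4 , s≤s z≤n , rank≤
  where
  rank≤ : ∀ n → 4 ≤ n → ∀ s → IsSigma n s →
    (f g : Fin s → Fin n) → StrictlyIncreasing f → StrictlyIncreasing g →
    BoolRank≤ (subMatrix (C-mat n) f g) (8 * ⌊log₂ ⌊log₂ n ⌋ ⌋)
  rank≤ n 4≤n s σ f g f↑ _ =
    k * 2 , [3+n]*2≤8*n 1≤l ,
    subMatrix-C-mat-factorization (strictlyIncreasing⇒injective f↑) g 2 k (σ<2^[3+⌊log₂⌊log₂n⌋⌋] σ)
    where
    l k : ℕ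
    l = ⌊log₂ ⌊log₂ n ⌋ ⌋
    k = 3 + l
    1≤l : 1 ≤ l
    1≤l = 2^m≤n⇒m≤⌊log₂n⌋ (2^m≤n⇒m≤⌊log₂n⌋ 4≤n)
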